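{- Let $\pi$ be a permutation (as in the context) with $\pi_1=1$. Suppose there are indices $i,j$ with $2\le i$, $i+2\le j\le n+1$, such that $|\pi_{i-1}-\pi_{j-1}|=1$, $|\pi_{i-1}-\pi_i|\neq 1$ and $|\pi_{j-1}-\pi_j|\neq1$ (a grey edge of Type 4 between $\pi_{i-1}$ and $\pi_{j-1}$). Then there is a prefix transreversal $\beta\tau$ with $b(\pi)-b(\pi\cdot\beta\tau)\ge 1$.
   Context: A permutation is $\pi=[\pi_0,\pi_1,\ldots,\pi_n,\pi_{n+1}]$ with $\pi_0=0$, $\pi_{n+1}=n+1$ and $(\pi_1,\ldots,\pi_n)$ a permutation of $\{1,\ldots,n\}$. A prefix transreversal $\beta\tau(1,j,k)$, for $2\le j\le n$ and $j<k\le n+1$, transforms $\pi$ into $[\pi_0,\pi_j,\ldots,\pi_{k-1},\pi_{j-1},\ldots,\pi_1,\pi_k,\ldots,\pi_{n+1}]$. Breakpoints: position $1$ is always a breakpoint; for $2\le i\le n+1$, position $i$ is a breakpoint iff $|\pi_i-\pi_{i-1}|\neq 1$. $b(\pi)$ is the number of breakpoints. In the breakpoint graph, consecutive entries $\pi_{i-1},\pi_i$ are joined by a black edge iff $|\pi_i-\pi_{i-1}|\neq1$, and non-consecutive entries with values differing by $1$ are joined by a grey edge; a Type 4 grey edge $(\pi_{i-1},\pi_{j-1})$ is one whose two endpoints both have a black edge to their right neighbours, as spelled out in the claim. -}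

module Defs where

open import Data.Nat using (ℕ; zero; suc; _+_; _∸_; _<ᵇ_; _≡ᵇ_; ∣_-_∣)
open import Data.Nat.Properties using ()
open import Data.Bool using (if_then_else_)
open import Data.Fin using (Fin; toℕ)
open import Data.Fin.Patterns using ()
open import Data.Fin.Permutation using (Permutation′; _⟨$⟩ʳ_)
open import Data.Fin using (fromℕ<)
open import Data.Nat.Properties using (≤-refl)
open import Data.List using (List; map; applyUpTo)
open import Data.Nat.ListAction using (sum)
open import Relation.Nullary using (yes; no)
open import Data.Nat using (_<?_)

-- A permutation of {1..n} is given by a permutation σ of Fin n; its extended
-- form is π = [π_0, π_1, ..., π_n, π_{n+1}] with π_0 = 0, π_{n+1} = n+1 and
-- π_p = 1 + σ(p-1) for 1 ≤ p ≤ n.  We represent π as a function of the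
-- position p : ℕ (positions beyond n+1 are irrelevant; they are set to n+1).
ext : (n : ℕ) → Permutation′ n → ℕ → ℕ
ext n σ zero = 0
ext n σ (suc k) with k <? n
... | yes k<n = suc (toℕ (σ ⟨$⟩ʳ fromℕ< k<n))
... | no _ = suc n

-- Prefix transreversal βτ(1,j,k) applied to a sequence ρ (positions as ℕ):
-- [ρ_0, ρ_j, ..., ρ_{k-1}, ρ_{j-1}, ..., ρ_1, ρ_k, ..., ρ_{n+1}]
transrev : (ℕ → ℕ) → ℕ → ℕ → (ℕ → ℕ)
transrev ρ j k p =
  if p ≡ᵇ 0 then ρ 0
  else if p <ᵇ suc (k ∸ j) then ρ (j + p ∸ 1)
  else if p <ᵇ k then ρ (k ∸ p)
  else ρ p

isBP : (ℕ → ℕ) → ℕ → ℕ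
isBP ρ i = if ∣ ρ i - ρ (i ∸ 1) ∣ ≡ᵇ 1 then 0 else 1

breakpoints : ℕ → (ℕ → ℕ) → ℕ
breakpoints n ρ = 1 + sum (applyUpTo (λ t → isBP ρ (t + 2)) n)

-- The transreversal βτ(1,i,j) turns π into π_0 π_i … π_{j-1} π_{i-1} … π_1 π_j … π_{n+1}.
-- Every adjacency inside the block π_i … π_{j-1}, inside the reversed block π_{i-1} … π_1
-- (read backwards) and from π_j on survives, so those positions contribute the same
-- breakpoints before and after.  The old breakpoints at positions i and j are gone; in their
-- place come the seam π_{j-1} π_{i-1}, which is an adjacency because of the grey edge, and
-- the seam π_1 π_j, which is at worst one new breakpoint.  So b drops by at least one.
module Submission where

open import Defs
open import Data.Bool using (true; false)
open import Data.Bool.Properties using (T-≡)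
open import Data.Fin.Permutation using (Permutation′)
open import Data.List using (applyUpTo; [_]; _∷ʳ_)
open import Data.List.Properties using (applyUpTo-∷ʳ)
open import Data.Nat using (ℕ; zero; suc; _+_; _∸_; _≤_; _<_; ∣_-_∣; z≤n; s≤s; z<s; s<s; _<ᵇ_)
open import Data.Nat.ListAction using (sum)
open import Data.Nat.ListAction.Properties using (sum-++)
open import Data.Nat.Properties
open import Data.Nat.Tactic.RingSolver using (solve-∀)
open import Data.Product using (Σ; _×_; _,_)
open import Function using (_∘_; Equivalence)
open import Relation.Binary.PropositionalEquality
  using (_≡_; _≢_; refl; sym; trans; cong; cong₂; subst; subst₂; module ≡-Reasoning)
open import Relation.Nullary using (contradiction)

sumUpTo : ℕ → (ℕ → ℕ) → ℕ
sumUpTo m f = sum (applyUpTo f m)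

sumUpTo-cong : ∀ m {f g : ℕ → ℕ} → (∀ {t} → t < m → f t ≡ g t) →
               sumUpTo m f ≡ sumUpTo m g
sumUpTo-cong zero    f≗g = refl
sumUpTo-cong (suc m) f≗g = cong₂ _+_ (f≗g z<s) (sumUpTo-cong m (f≗g ∘ s<s))

sumUpTo-snoc : ∀ m f → sumUpTo (suc m) f ≡ sumUpTo m f + f m
sumUpTo-snoc m f = begin
  sum (applyUpTo f (suc m))      ≡⟨ cong sum (applyUpTo-∷ʳ f m) ⟨
  sum (applyUpTo f m ∷ʳ f m)     ≡⟨ sum-++ (applyUpTo f m) [ f m ] ⟩
  sumUpTo m f + (f m + 0)        ≡⟨ cong (sumUpTo m f +_) (+-identityʳ (f m)) ⟩
  sumUpTo m f + f m              ∎
  where open ≡-Reasoning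

sumUpTo-split : ∀ m k f →
  sumUpTo (m + suc k) f ≡ sumUpTo m f + (f m + sumUpTo k (λ t → f (suc m + t)))
sumUpTo-split zero    k f = refl
sumUpTo-split (suc m) k f =
  trans (cong (f 0 +_) (sumUpTo-split m k (f ∘ suc))) (sym (+-assoc (f 0) _ _))

sumUpTo-segments : ∀ k l m f →
  sumUpTo (k + suc (l + suc m)) f ≡
    sumUpTo k f + (f k + (sumUpTo l (λ t → f (suc k + t)) +
      (f (suc k + l) + sumUpTo m (λ t → f (suc k + (suc l + t))))))
sumUpTo-segments k l m f =
  trans (sumUpTo-split k (l + suc m) f)
        (cong (λ s → sumUpTo k f + (f k + s)) (sumUpTo-split l m (λ t → f (suc k + t))))

sumUpTo-reflect : ∀ m {f g : ℕ → ℕ} → (∀ {t u} → t + suc u ≡ m → f t ≡ g u) →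
                  sumUpTo m f ≡ sumUpTo m g
sumUpTo-reflect zero    f≗g = refl
sumUpTo-reflect (suc m) {f} {g} f≗g = begin
  f 0 + sumUpTo m (f ∘ suc)  ≡⟨ cong₂ _+_ (f≗g refl) (sumUpTo-reflect m (f≗g ∘ cong suc)) ⟩
  g m + sumUpTo m g          ≡⟨ +-comm (g m) _ ⟩
  sumUpTo m g + g m          ≡⟨ sumUpTo-snoc m g ⟨
  sumUpTo (suc m) g          ∎
  where open ≡-Reasoning

breakpoints-sumUpTo : ∀ n ρ → breakpoints n ρ ≡ 1 + sumUpTo n (λ t → isBP ρ (2 + t))
breakpoints-sumUpTo n ρ = cong suc (sumUpTo-cong n (λ {t} _ → cong (isBP ρ) (+-comm t 2)))

isBP≤1 : ∀ ρ p → isBP ρ p ≤ 1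
isBP≤1 ρ p with ∣ ρ p - ρ (p ∸ 1) ∣
... | 1           = z≤n
... | 0           = s≤s z≤n
... | suc (suc _) = s≤s z≤n

isBP≡0 : ∀ ρ p → ∣ ρ (suc p) - ρ p ∣ ≡ 1 → isBP ρ (suc p) ≡ 0
isBP≡0 ρ p adj rewrite adj = refl

isBP≡1 : ∀ ρ p → ∣ ρ (suc p) - ρ p ∣ ≢ 1 → isBP ρ (suc p) ≡ 1
isBP≡1 ρ p ¬adj with ∣ ρ (suc p) - ρ p ∣
... | 1           = contradiction refl ¬adj
... | 0           = refl
... | suc (suc _) = refl

isBP-cong : ∀ (ρ′ ρ : ℕ → ℕ) p q → ρ′ (suc p) ≡ ρ (suc q) → ρ′ p ≡ ρ q →
            isBP ρ′ (suc p) ≡ isBP ρ (suc q)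
isBP-cong ρ′ ρ p q e e′ rewrite e | e′ = refl

isBP-flip : ∀ (ρ′ ρ : ℕ → ℕ) p q → ρ′ (suc p) ≡ ρ q → ρ′ p ≡ ρ (suc q) →
            isBP ρ′ (suc p) ≡ isBP ρ (suc q)
isBP-flip ρ′ ρ p q e e′ rewrite e | e′ | ∣-∣-comm (ρ q) (ρ (suc q)) = refl

<ᵇ-true : ∀ {m n} → m < n → (m <ᵇ n) ≡ true
<ᵇ-true = Equivalence.to T-≡ ∘ <⇒<ᵇ

<ᵇ-false : ∀ {m n} → n ≤ m → (m <ᵇ n) ≡ false
<ᵇ-false {m}     {zero}  z≤n       = refl
<ᵇ-false {suc m} {suc n} (s≤s n≤m) = <ᵇ-false n≤m

transrev-block : ∀ ρ i j q → q < j ∸ i → transrev ρ i j (suc q) ≡ ρ (i + q)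
transrev-block ρ i j q q<d rewrite <ᵇ-true (s≤s q<d) | +-suc i q = refl

transrev-reversed : ∀ ρ i j q r → j ∸ i ≤ q → suc q + suc r ≡ j →
                    transrev ρ i j (suc q) ≡ ρ (suc r)
transrev-reversed ρ i _ q r d≤q refl
  rewrite <ᵇ-false (s≤s d≤q) | <ᵇ-true (m<m+n (suc q) (z<s {r})) | m+n∸m≡n (suc q) (suc r) = refl

transrev-suffix : ∀ ρ i j q → 1 ≤ i → j ≤ suc q → transrev ρ i j (suc q) ≡ ρ (suc q)
transrev-suffix ρ i j q 1≤i j≤1+q
  rewrite <ᵇ-false (s≤s (≤-trans (∸-monoʳ-≤ j 1≤i) (∸-monoˡ-≤ 1 j≤1+q))) | <ᵇ-false j≤1+q = refl

module Type4Edge (ρ : ℕ → ℕ) (a b c : ℕ) where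

  i j n : ℕ
  i = 2 + a
  j = i + 2 + b
  n = a + suc (suc b + suc c)

  ρ′ : ℕ → ℕ
  ρ′ = transrev ρ i j

  old new : ℕ → ℕ
  old t = isBP ρ (2 + t)
  new t = isBP ρ′ (2 + t)

  j∸i : j ∸ i ≡ 2 + b
  j∸i = trans (cong (_∸ i) (+-assoc i 2 b)) (m+n∸m≡n i (2 + b))

  block : ∀ {q} → q ≤ suc b → ρ′ (suc q) ≡ ρ (i + q)
  block {q} q≤1+b = transrev-block ρ i j q (subst (q <_) (sym j∸i) (s≤s q≤1+b))

  reversed : ∀ q r → 2 + b ≤ q → suc q + suc r ≡ j → ρ′ (suc q) ≡ ρ (suc r)
  reversed q r 2+b≤q = transrev-reversed ρ i j q r (subst (_≤ q) (sym j∸i) 2+b≤q)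

  new-block : ∀ {t} → t ≤ b → new t ≡ old (suc a + t)
  new-block {t} t≤b = isBP-cong ρ′ ρ (suc t) (i + t)
    (trans (block (s≤s t≤b)) (cong ρ (+-suc i t)))
    (block (m≤n⇒m≤1+n t≤b))

  new-joined : ∣ ρ (i ∸ 1) - ρ (j ∸ 1) ∣ ≡ 1 → new (suc b) ≡ 0
  new-joined adj = isBP≡0 ρ′ (2 + b) (subst₂ (λ x y → ∣ x - y ∣ ≡ 1) (sym left) (sym right) adj)
    where
    left : ρ′ (3 + b) ≡ ρ (suc a)
    left = reversed (2 + b) a ≤-refl (arith a b)
      where
      arith : ∀ a b → 3 + b + suc a ≡ 2 + a + 2 + b
      arith = solve-∀
    right : ρ′ (2 + b) ≡ ρ (j ∸ 1)
    right = trans (block ≤-refl) (cong ρ (arith a b))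
      where
      arith : ∀ a b → 2 + a + suc b ≡ suc (a + 2 + b)
      arith = solve-∀

  new-reflected : ∀ {t u} → t + suc u ≡ a → new (2 + b + t) ≡ old u
  new-reflected {t} {u} t+1+u≡a = isBP-flip ρ′ ρ (3 + b + t) (suc u)
    (reversed (3 + b + t) u (m≤n⇒m≤1+n 2+b≤2+b+t) (trans (arith₁ t u b) (cong j′ t+1+u≡a)))
    (reversed (2 + b + t) (suc u) 2+b≤2+b+t (trans (arith₂ t u b) (cong j′ t+1+u≡a)))
    where
    2+b≤2+b+t : 2 + b ≤ 2 + b + t
    2+b≤2+b+t = s≤s (s≤s (m≤m+n b t))
    j′ : ℕ → ℕ
    j′ x = 2 + x + 2 + b
    arith₁ : ∀ t u b → 4 + b + t + suc u ≡ 2 + (t + suc u) + 2 + b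
    arith₁ = solve-∀
    arith₂ : ∀ t u b → 3 + b + t + suc (suc u) ≡ 2 + (t + suc u) + 2 + b
    arith₂ = solve-∀

  new-suffix : ∀ t → new (j ∸ 1 + t) ≡ old (j ∸ 1 + t)
  new-suffix t = isBP-cong ρ′ ρ (j + t) (j + t)
    (transrev-suffix ρ i j (j + t) (s≤s z≤n) (m≤n⇒m≤1+n (m≤m+n j t)))
    (transrev-suffix ρ i j (j ∸ 1 + t) (s≤s z≤n) (m≤m+n j t))

  -- Breakpoint counts of π on the three stretches that βτ(1,i,j) moves as wholes:
  -- positions 2 … i-1, i+1 … j-1 and j+1 … n+1.
  A B C : ℕ
  A = sumUpTo a old
  B = sumUpTo (suc b) (λ t → old (suc a + t))
  C = sumUpTo c (λ t → old (suc a + (suc (suc b) + t)))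

  new-at-j : ℕ
  new-at-j = new (suc (suc b) + a)

  old-total : ∣ ρ (i ∸ 1) - ρ i ∣ ≢ 1 → ∣ ρ (j ∸ 1) - ρ j ∣ ≢ 1 →
              sumUpTo n old ≡ A + (1 + (B + (1 + C)))
  old-total ¬adjᵢ ¬adjⱼ = trans (sumUpTo-segments a (suc b) c old)
    (cong (λ x → A + x) (cong₂ _+_ at-i (cong (B +_) (cong (_+ C) at-j))))
    where
    at-i : old a ≡ 1
    at-i = isBP≡1 ρ (suc a) (¬adjᵢ ∘ trans (∣-∣-comm (ρ (suc a)) (ρ i)))
    at-j : old (suc a + suc b) ≡ 1
    at-j = trans (cong (isBP ρ) (arith a b)) (isBP≡1 ρ (j ∸ 1) (¬adjⱼ ∘ trans (∣-∣-comm (ρ (j ∸ 1)) (ρ j))))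
      where
      arith : ∀ a b → 2 + (suc a + suc b) ≡ 2 + a + 2 + b
      arith = solve-∀

  new-total : ∣ ρ (i ∸ 1) - ρ (j ∸ 1) ∣ ≡ 1 →
              sumUpTo n new ≡ B + (0 + (A + (new-at-j + C)))
  new-total adj = trans (cong (λ m → sumUpTo m new) (arith a b c))
    (trans (sumUpTo-segments (suc b) a c new)
      (cong₂ _+_ (sumUpTo-cong (suc b) (new-block ∘ ≤-pred))
        (cong₂ _+_ (new-joined adj)
          (cong₂ _+_ (sumUpTo-reflect a new-reflected)
            (cong (new-at-j +_) (sumUpTo-cong c λ {t} _ → suffix t))))))
    where
    arith : ∀ a b c → a + suc (suc b + suc c) ≡ suc b + suc (a + suc c)
    arith = solve-∀
    suffix : ∀ t → new (suc (suc b) + (suc a + t)) ≡ old (suc a + (suc (suc b) + t))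
    suffix t = trans (cong new (arith₁ a b t)) (trans (new-suffix t) (cong old (arith₂ a b t)))
      where
      arith₁ : ∀ a b t → suc (suc b) + (suc a + t) ≡ suc (a + 2 + b) + t
      arith₁ = solve-∀
      arith₂ : ∀ a b t → suc (a + 2 + b) + t ≡ suc a + (suc (suc b) + t)
      arith₂ = solve-∀

  length-decomposition : ∀ {m} → j + c ≡ m + 1 → m ≡ n
  length-decomposition {m} j+c≡m+1 =
    suc-injective (trans (+-comm 1 m) (trans (sym j+c≡m+1) (arith a b c)))
    where
    arith : ∀ a b c → 2 + a + 2 + b + c ≡ suc (a + suc (suc b + suc c))
    arith = solve-∀

  removes-breakpoint : ∀ {m} → j + c ≡ m + 1 → ∣ ρ (i ∸ 1) - ρ (j ∸ 1) ∣ ≡ 1 →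
    ∣ ρ (i ∸ 1) - ρ i ∣ ≢ 1 → ∣ ρ (j ∸ 1) - ρ j ∣ ≢ 1 → 1 + breakpoints m ρ′ ≤ breakpoints m ρ
  removes-breakpoint j+c≡m+1 adj ¬adjᵢ ¬adjⱼ with refl ← length-decomposition j+c≡m+1 = begin
    1 + breakpoints n ρ′                          ≡⟨ cong suc (breakpoints-sumUpTo n ρ′) ⟩
    2 + sumUpTo n new                             ≡⟨ cong (2 +_) (new-total adj) ⟩
    2 + (B + (A + (new-at-j + C)))                ≤⟨ s≤s (s≤s (+-monoʳ-≤ B (+-monoʳ-≤ A (+-monoˡ-≤ C new-at-j≤1)))) ⟩
    2 + (B + (A + (1 + C)))                       ≡⟨ cong suc (arith A B C) ⟩
    1 + (A + (1 + (B + (1 + C))))                 ≡⟨ cong suc (old-total ¬adjᵢ ¬adjⱼ) ⟨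
    1 + sumUpTo n old                             ≡⟨ breakpoints-sumUpTo n ρ ⟨
    breakpoints n ρ                               ∎
    where
    open ≤-Reasoning
    new-at-j≤1 : new-at-j ≤ 1
    new-at-j≤1 = isBP≤1 ρ′ (2 + (suc (suc b) + a))
    arith : ∀ A B C → suc (B + (A + (1 + C))) ≡ A + (1 + (B + (1 + C)))
    arith = solve-∀

transrev-removes-breakpoint : (ρ : ℕ → ℕ) (n i j : ℕ) → 2 ≤ i → i + 2 ≤ j → j ≤ n + 1 →
  ∣ ρ (i ∸ 1) - ρ (j ∸ 1) ∣ ≡ 1 → ∣ ρ (i ∸ 1) - ρ i ∣ ≢ 1 → ∣ ρ (j ∸ 1) - ρ j ∣ ≢ 1 →
  1 + breakpoints n (transrev ρ i j) ≤ breakpoints n ρ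
transrev-removes-breakpoint ρ n (suc (suc a)) j (s≤s (s≤s z≤n)) i+2≤j j≤n+1
  with b , refl ← m≤n⇒∃[o]m+o≡n i+2≤j
  with c , j+c≡n+1 ← m≤n⇒∃[o]m+o≡n j≤n+1 =
  Type4Edge.removes-breakpoint ρ a b c j+c≡n+1

lemma7 : (n : ℕ) (σ : Permutation′ n) →
    ext n σ 1 ≡ 1 →
    (i j : ℕ) → 2 ≤ i → i + 2 ≤ j → j ≤ n + 1 →
    ∣ ext n σ (i ∸ 1) - ext n σ (j ∸ 1) ∣ ≡ 1 →
    ∣ ext n σ (i ∸ 1) - ext n σ i ∣ ≢ 1 →
    ∣ ext n σ (j ∸ 1) - ext n σ j ∣ ≢ 1 →
    Σ ℕ λ a → Σ ℕ λ c → (2 ≤ a) × (a ≤ n) × (a < c) × (c ≤ n + 1) ×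
      (1 + breakpoints n (transrev (ext n σ) a c) ≤ breakpoints n (ext n σ))
lemma7 n σ _ i j 2≤i i+2≤j j≤n+1 adj ¬adjᵢ ¬adjⱼ =
  i , j , 2≤i , i≤n , i<j , j≤n+1 ,
  transrev-removes-breakpoint (ext n σ) n i j 2≤i i+2≤j j≤n+1 adj ¬adjᵢ ¬adjⱼ
  where
  i<j : i < j
  i<j = <-≤-trans (m<m+n i z<s) i+2≤j
  i≤n : i ≤ n
  i≤n = ≤-pred (subst (i <_) (+-comm n 1) (<-≤-trans i<j j≤n+1))
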